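{- Let $H$ be a $3$-graph on $h\ge 3$ vertices and let $\{u,v,w\}$ be a triple of vertices of $H$ such that no pair of them lies together in an edge of $H$. Let $H'$ be the $3$-graph obtained by adding the edge $\{u,v,w\}$ to $H$. Then for every $n\ge 1$, $r(H',K_{n,n,n}^{(3)})\le 3n\cdot r(H,K_{n,n,n}^{(3)})^h$.
   Context: A $3$-graph is a $3$-uniform hypergraph. For $3$-graphs $H_1,H_2$, $r(H_1,H_2)$ is the smallest $N$ such that every $3$-graph on $N$ vertices contains $H_1$ or its complement contains $H_2$. $K_{n,n,n}^{(3)}$ is the complete tripartite $3$-graph with three parts of size $n$, whose edges are the triples with one vertex in each part. -}

module Defs where

open import Data.Nat using (ℕ; _<_; _≤_; _*_; _^_)
open import Data.Fin using (Fin)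
open import Data.Fin.Properties using (_≟_)
open import Data.Bool using (Bool; true; false; not; _∧_; _∨_)
open import Data.Bool.Properties using (∧-comm; ∧-assoc)
open import Data.Product using (Σ; _×_; _,_)
open import Data.Sum using (_⊎_)
open import Relation.Nullary using (¬_)
open import Relation.Nullary.Decidable using (⌊_⌋)
open import Relation.Binary.PropositionalEquality using (_≡_; _≢_; refl; cong; sym; trans)
open import Function.Definitions using (Injective)

-- Only triples of pairwise distinct
-- vertices are ever consulted (values on degenerate triples are irrelevant);
-- the edge {a,b,c} is present iff edge a b c ≡ true.
record 3Graph (V : Set) : Set where
  field
    edge  : V → V → V → Bool
    sym₁₂ : ∀ a b c → edge a b c ≡ edge b a c
    sym₂₃ : ∀ a b c → edge a b c ≡ edge a c b
open 3Graph public

Distinct3 : {V : Set} → V → V → V → Set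
Distinct3 a b c = (a ≢ b) × (b ≢ c) × (a ≢ c)

complement : {V : Set} → 3Graph V → 3Graph V
complement G = record
  { edge  = λ a b c → not (edge G a b c)
  ; sym₁₂ = λ a b c → cong not (sym₁₂ G a b c)
  ; sym₂₃ = λ a b c → cong not (sym₂₃ G a b c) }

Contains : {V W : Set} → 3Graph V → 3Graph W → Set
Contains {V} {W} G H =
  Σ (W → V) λ f → Injective _≡_ _≡_ f ×
    (∀ a b c → Distinct3 a b c → edge H a b c ≡ true →
       edge G (f a) (f b) (f c) ≡ true)

Arrows : {V W : Set} → ℕ → 3Graph V → 3Graph W → Set
Arrows N H₁ H₂ = (G : 3Graph (Fin N)) → Contains G H₁ ⊎ Contains (complement G) H₂

IsRamseyNumber : {V W : Set} → 3Graph V → 3Graph W → ℕ → Set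
IsRamseyNumber H₁ H₂ r = Arrows r H₁ H₂ × (∀ N → N < r → ¬ Arrows N H₁ H₂)

_≠ᵇ_ : ∀ {k} → Fin k → Fin k → Bool
i ≠ᵇ j = not ⌊ i ≟ j ⌋

≠ᵇ-sym : ∀ {k} (i j : Fin k) → i ≠ᵇ j ≡ j ≠ᵇ i
≠ᵇ-sym i j with i ≟ j | j ≟ i
... | Relation.Nullary.yes _ | Relation.Nullary.yes _ = refl
... | Relation.Nullary.no _  | Relation.Nullary.no _  = refl
... | Relation.Nullary.yes p | Relation.Nullary.no q = Data.Empty.⊥-elim (q (sym p))
  where import Data.Empty
... | Relation.Nullary.no q  | Relation.Nullary.yes p = Data.Empty.⊥-elim (q (sym p))
  where import Data.Empty

∧3-swap₁₂ : ∀ x y z → (x ∧ y ∧ z) ≡ (y ∧ x ∧ z)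
∧3-swap₁₂ true  true  z = refl
∧3-swap₁₂ true  false z = refl
∧3-swap₁₂ false true  z = refl
∧3-swap₁₂ false false z = refl

Knnn : (n : ℕ) → 3Graph (Fin 3 × Fin n)
Knnn n = record
  { edge  = λ { (i , _) (j , _) (k , _) → (i ≠ᵇ j) ∧ (j ≠ᵇ k) ∧ (i ≠ᵇ k) }
  ; sym₁₂ = λ { (i , _) (j , _) (k , _) → s₁₂ i j k }
  ; sym₂₃ = λ { (i , _) (j , _) (k , _) → s₂₃ i j k } }
  where
  s₁₂ : ∀ (i j k : Fin 3) → ((i ≠ᵇ j) ∧ (j ≠ᵇ k) ∧ (i ≠ᵇ k)) ≡ ((j ≠ᵇ i) ∧ (i ≠ᵇ k) ∧ (j ≠ᵇ k))
  s₁₂ i j k rewrite ≠ᵇ-sym i j = cong ((j ≠ᵇ i) ∧_) (∧-comm (j ≠ᵇ k) (i ≠ᵇ k))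
  s₂₃ : ∀ (i j k : Fin 3) → ((i ≠ᵇ j) ∧ (j ≠ᵇ k) ∧ (i ≠ᵇ k)) ≡ ((i ≠ᵇ k) ∧ (k ≠ᵇ j) ∧ (i ≠ᵇ j))
  s₂₃ i j k rewrite ≠ᵇ-sym j k =
    trans (∧3-swap₁₂ (i ≠ᵇ j) (k ≠ᵇ j) (i ≠ᵇ k))
      (cong ((k ≠ᵇ j) ∧_) (∧-comm (i ≠ᵇ j) (i ≠ᵇ k)) ) |> λ p → trans p (∧3-swap₁₂ (k ≠ᵇ j) (i ≠ᵇ k) (i ≠ᵇ j))
    where open import Function using (_|>_)

-- H with the edge {u,v,w} added (for distinct a,b,c and distinct u,v,w,
-- {a,b,c} = {u,v,w} iff each of a,b,c lies in {u,v,w})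
addEdge : ∀ {h} → 3Graph (Fin h) → Fin h → Fin h → Fin h → 3Graph (Fin h)
addEdge H u v w = record
  { edge  = λ a b c → edge H a b c ∨ (m a ∧ m b ∧ m c)
  ; sym₁₂ = λ a b c → cong₂' (sym₁₂ H a b c) (∧3-swap₁₂ (m a) (m b) (m c))
  ; sym₂₃ = λ a b c → cong₂' (sym₂₃ H a b c) (cong (m a ∧_) (∧-comm (m b) (m c))) }
  where
  m : Fin _ → Bool
  m x = not (x ≠ᵇ u) ∨ not (x ≠ᵇ v) ∨ not (x ≠ᵇ w)
  cong₂' : ∀ {x x' y y'} → x ≡ x' → y ≡ y' → (x ∨ y) ≡ (x' ∨ y')
  cong₂' refl refl = refl

PairFree : ∀ {h} → 3Graph (Fin h) → Fin h → Fin h → Fin h → Set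
PairFree H u v w =
  (∀ c → Distinct3 u v c → edge H u v c ≡ false) ×
  (∀ c → Distinct3 u w c → edge H u w c ≡ false) ×
  (∀ c → Distinct3 v w c → edge H v w c ≡ false)

-- Relabel H so that u, v, w become its vertices 0, 1, 2, and call the remaining k = h - 3
-- vertices the rest. Deleting vertices one at a time and double counting shows that if
-- r → (H, K) then every 3-graph G on N ≥ r vertices either has K in its complement or contains
-- at least (N)_h / (r)_h ≥ (N / r)^h labelled copies of H. A labelled copy of H is a copy of
-- the rest together with, for each j ∈ {0, 1, 2}, a candidate vertex forming the right edges
-- with the rest; as no edge of H contains two of u, v, w, the three candidates are independent.
-- For N = 3n·r^h, (N / r)^h = 3n·N^(h-1) exceeds the N^k·(3n - 1)·N² copies that would exist
-- if every copy of the rest had fewer than 3n candidates for some j. So some copy of the rest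
-- has 3n candidates for each j, and we may choose n of them for each j, all distinct. If some
-- choice of one candidate per j spans an edge of G, we get a copy of H + uvw; otherwise these
-- three n-sets span K_{n,n,n} in the complement of G.

module Submission where

open import Defs
open import Data.Nat using (ℕ; _≤_; _*_; _^_)
open import Data.Fin using (Fin)

open import Data.Bool.Base using (Bool; true; false; not; _∨_; if_then_else_)
open import Data.Bool.Properties using (¬-not; ∧-conicalˡ; ∧-conicalʳ) renaming (_≟_ to _≟ᴮ_)
open import Data.Empty using (⊥; ⊥-elim)
open import Data.Fin.Base using (zero; suc; punchIn; punchOut; _↑ˡ_; _↑ʳ_)
open import Data.Fin.Patterns using (0F; 1F; 2F)
open import Data.Fin.Permutation using (Permutation′; _⟨$⟩ʳ_; _⟨$⟩ˡ_; insert; id; inverseˡ; inverseʳ)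
open import Data.Fin.Properties
  using (_≟_; all?; any?; ¬∀⟶∃¬; suc-injective; ↑ʳ-injective; punchInᵢ≢i; punchIn-injective;
         punchIn-punchOut; injective⇒≤)
open import Data.Nat.Base
  using (zero; suc; _+_; _∸_; _<_; pred; _≤′_; ≤′-refl; ≤′-step; z≤n; s≤s; >-nonZero)
open import Data.Nat.Combinatorics.Base using (_P′_)
open import Data.Nat.Properties
  using (≤-refl; ≤-trans; ≤-reflexive; ≤-pred; +-monoʳ-≤; _≤?_; ≰⇒>; <⇒≤pred; n≤1+n; n≮n; ≤′⇒≤; ≤⇒≤′;
         +-comm; +-suc; +-identityʳ; +-mono-≤; +-cancelˡ-≡; +-cancelʳ-≤; m≤m+n; m+n∸n≡m;
         *-comm; *-assoc; *-identityˡ; *-identityʳ; *-zeroʳ; *-mono-≤; *-monoˡ-≤; *-monoʳ-≤; *-mono-<;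
         *-cancelˡ-≤; *-cancelʳ-≤; *-distribʳ-∸; ∸-monoʳ-≤; m<n⇒0<n∸m; m≤m*n; m≤n*m; m^n>0;
         module ≤-Reasoning; +-*-semiring)
open import Data.Nat.Tactic.RingSolver using (solve-∀)
open import Data.Product using (∃; _×_; _,_; proj₁; proj₂)
open import Data.Sum using (_⊎_; inj₁; inj₂; map₁)
open import Data.Vec.Base using (Vec; []; _∷_; lookup; map; tabulate)
open import Data.Vec.Functional using (_++_) renaming (_∷_ to _∷ᶠ_; [] to []ᶠ)
open import Data.Vec.Functional.Properties using (lookup-++ˡ)
open import Data.Vec.Properties using (lookup-map; lookup∘tabulate)
open import Function.Base using (_∘_)
open import Function.Bundles using (_⇔_; mk⇔; Equivalence)
open import Function.Definitions using (Injective)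
open import Level using (0ℓ)
open import Relation.Binary.PropositionalEquality
open import Relation.Nullary using (Dec; yes; no; ¬_; does)
open import Relation.Nullary.Decidable
  using (map′; _×-dec_; _→-dec_; ¬?; dec-true; dec-false; does-⇔; toSum)
open import Relation.Unary using (Pred; Decidable)
open import Algebra.Properties.Semiring.Sum +-*-semiring
  using (sum; sum-syntax; sum-remove; sum-cong-≗; ∑-comm; ∑-distrib-+; *-distribˡ-sum; *-distribʳ-sum)

-- Embeddings

module _ {W V : Set} where

  EdgePreserving : 3Graph W → 3Graph V → (W → V) → Set
  EdgePreserving H G f = ∀ a b c → Distinct3 a b c → edge H a b c ≡ true →
    edge G (f a) (f b) (f c) ≡ true

  IsEmbedding : 3Graph W → 3Graph V → (W → V) → Set
  IsEmbedding H G f = Injective _≡_ _≡_ f × EdgePreserving H G f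

pullback : {W V : Set} → (W → V) → 3Graph V → 3Graph W
pullback p G = record
  { edge  = λ a b c → edge G (p a) (p b) (p c)
  ; sym₁₂ = λ a b c → sym₁₂ G (p a) (p b) (p c)
  ; sym₂₃ = λ a b c → sym₂₃ G (p a) (p b) (p c) }

edge-cong : ∀ {V : Set} (G : 3Graph V) {a b c a′ b′ c′} → a ≡ a′ → b ≡ b′ → c ≡ c′ →
  edge G a b c ≡ edge G a′ b′ c′
edge-cong G refl refl refl = refl

module _ {A : Set} where

  Distinct3-swap₁₂ : {a b c : A} → Distinct3 a b c → Distinct3 b a c
  Distinct3-swap₁₂ (a≢b , b≢c , a≢c) = a≢b ∘ sym , a≢c , b≢c

  Distinct3-swap₂₃ : {a b c : A} → Distinct3 a b c → Distinct3 a c b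
  Distinct3-swap₂₃ (a≢b , b≢c , a≢c) = a≢c , b≢c ∘ sym , a≢b

  Distinct3-map : {B : Set} {f : A → B} → Injective _≡_ _≡_ f →
    {a b c : A} → Distinct3 a b c → Distinct3 (f a) (f b) (f c)
  Distinct3-map f-inj (a≢b , b≢c , a≢c) = a≢b ∘ f-inj , b≢c ∘ f-inj , a≢c ∘ f-inj

  Distinct3-unmap : {B : Set} (f : A → B) {a b c : A} →
    Distinct3 (f a) (f b) (f c) → Distinct3 a b c
  Distinct3-unmap f (fa≢fb , fb≢fc , fa≢fc) = fa≢fb ∘ cong f , fb≢fc ∘ cong f , fa≢fc ∘ cong f

module _ {W V : Set} {H : 3Graph W} where

  IsEmbedding-resp-≗ : {G : 3Graph V} {f g : W → V} → f ≗ g → IsEmbedding H G f → IsEmbedding H G g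
  IsEmbedding-resp-≗ {G} {f} {g} f≗g (f-inj , f-edges) =
    (λ {x} {y} gx≡gy → f-inj (trans (f≗g x) (trans gx≡gy (sym (f≗g y))))) ,
    λ a b c d e → trans (sym (edge-cong G (f≗g a) (f≗g b) (f≗g c))) (f-edges a b c d e)

  IsEmbedding-restrict : {U : Set} {G : 3Graph V} {σ : U → W} {f : W → V} → Injective _≡_ _≡_ σ →
    IsEmbedding H G f → IsEmbedding (pullback σ H) G (f ∘ σ)
  IsEmbedding-restrict σ-inj (f-inj , f-edges) =
    σ-inj ∘ f-inj , λ a b c d → f-edges _ _ _ (Distinct3-map σ-inj d)

  IsEmbedding-pullback : {X : Set} {G : 3Graph X} {p : V → X} {f : W → V} → Injective _≡_ _≡_ p →
    IsEmbedding H (pullback p G) f ⇔ IsEmbedding H G (p ∘ f)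
  IsEmbedding-pullback {p = p} p-inj = mk⇔
    (λ (f-inj , f-edges) → f-inj ∘ p-inj , f-edges)
    (λ (pf-inj , pf-edges) → pf-inj ∘ cong p , pf-edges)

  IsEmbedding-⊆ : {H′ : 3Graph W} {G : 3Graph V} {f : W → V} →
    (∀ a b c → edge H′ a b c ≡ true → edge H a b c ≡ true) → IsEmbedding H G f → IsEmbedding H′ G f
  IsEmbedding-⊆ H′⊆H (f-inj , f-edges) = f-inj , λ a b c d → f-edges a b c d ∘ H′⊆H a b c

Contains-pullback : {W V X : Set} {K : 3Graph W} {G : 3Graph X} {p : V → X} →
  Injective _≡_ _≡_ p → Contains (pullback p G) K → Contains G K
Contains-pullback {K = K} {G = G} {p} p-inj (f , f-emb) =
  p ∘ f , Equivalence.to (IsEmbedding-pullback {H = K} {G = G} p-inj) f-emb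

PairFree-pullback : ∀ {h h′} {H : 3Graph (Fin h)} {σ : Fin h′ → Fin h} → Injective _≡_ _≡_ σ →
  ∀ {a b c u v w} → σ a ≡ u → σ b ≡ v → σ c ≡ w → PairFree H u v w → PairFree (pullback σ H) a b c
PairFree-pullback {σ = σ} σ-inj refl refl refl (free-uv , free-uw , free-vw) =
  (λ x d → free-uv (σ x) (Distinct3-map σ-inj d)) ,
  (λ x d → free-uw (σ x) (Distinct3-map σ-inj d)) ,
  (λ x d → free-vw (σ x) (Distinct3-map σ-inj d))

distinct3? : ∀ {h} (a b c : Fin h) → Dec (Distinct3 a b c)
distinct3? a b c = ¬? (a ≟ b) ×-dec ¬? (b ≟ c) ×-dec ¬? (a ≟ c)

isEmbedding? : ∀ {h m} (H : 3Graph (Fin h)) (G : 3Graph (Fin m)) (f : Fin h → Fin m) →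
  Dec (IsEmbedding H G f)
isEmbedding? H G f = injective? ×-dec edgePreserving?
  where
  injective? : Dec (Injective _≡_ _≡_ f)
  injective? = map′ (λ inj {x} {y} → inj x y) (λ inj x y → inj)
    (all? λ x → all? λ y → (f x ≟ f y) →-dec (x ≟ y))
  edgePreserving? : Dec (EdgePreserving H G f)
  edgePreserving? = all? λ a → all? λ b → all? λ c →
    distinct3? a b c →-dec edge H a b c ≟ᴮ true →-dec edge G (f a) (f b) (f c) ≟ᴮ true

module _ {X : Set} (part : X → Fin 3) (R : X → X → X → Set)
  (R-swap₁₂ : ∀ {a b c} → R a b c → R b a c) (R-swap₂₃ : ∀ {a b c} → R a b c → R a c b) where

  fromOrderedParts : (∀ {a b c} → part a ≡ 0F → part b ≡ 1F → part c ≡ 2F → R a b c) →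
    ∀ {a b c} → Distinct3 (part a) (part b) (part c) → R a b c
  fromOrderedParts R₀₁₂ {a} {b} {c} d with part a in pa | part b in pb | part c in pc
  ... | 0F | 1F | 2F = R₀₁₂ pa pb pc
  ... | 0F | 2F | 1F = R-swap₂₃ (R₀₁₂ pa pc pb)
  ... | 1F | 0F | 2F = R-swap₁₂ (R₀₁₂ pb pa pc)
  ... | 1F | 2F | 0F = R-swap₂₃ (R-swap₁₂ (R₀₁₂ pc pa pb))
  ... | 2F | 0F | 1F = R-swap₁₂ (R-swap₂₃ (R₀₁₂ pb pc pa))
  ... | 2F | 1F | 0F = R-swap₁₂ (R-swap₂₃ (R-swap₁₂ (R₀₁₂ pc pb pa)))
  ... | 0F | 0F | _  = ⊥-elim (proj₁ d refl)
  ... | 1F | 1F | _  = ⊥-elim (proj₁ d refl)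
  ... | 2F | 2F | _  = ⊥-elim (proj₁ d refl)
  ... | _  | 0F | 0F = ⊥-elim (proj₁ (proj₂ d) refl)
  ... | _  | 1F | 1F = ⊥-elim (proj₁ (proj₂ d) refl)
  ... | _  | 2F | 2F = ⊥-elim (proj₁ (proj₂ d) refl)
  ... | 0F | _  | 0F = ⊥-elim (proj₂ (proj₂ d) refl)
  ... | 1F | _  | 1F = ⊥-elim (proj₂ (proj₂ d) refl)
  ... | 2F | _  | 2F = ⊥-elim (proj₂ (proj₂ d) refl)

∈-triple : ∀ {h} {u v w x : Fin h} → (not (x ≠ᵇ u) ∨ not (x ≠ᵇ v) ∨ not (x ≠ᵇ w)) ≡ true →
  ∃ λ i → lookup (u ∷ v ∷ w ∷ []) i ≡ x
∈-triple {u = u} {v} {w} {x} e with x ≟ u | x ≟ v | x ≟ w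
... | yes x≡u | _       | _       = 0F , sym x≡u
... | no _    | yes x≡v | _       = 1F , sym x≡v
... | no _    | no _    | yes x≡w = 2F , sym x≡w
∈-triple () | no _ | no _ | no _

Contains-addEdge : ∀ {h} {V : Set} {H : 3Graph (Fin h)} {G : 3Graph V} {u v w} {f : Fin h → V} →
  IsEmbedding H G f → edge G (f u) (f v) (f w) ≡ true → Contains G (addEdge H u v w)
Contains-addEdge {H = H} {G} {u} {v} {w} {f} (f-inj , f-edges) e-uvw = f , f-inj , preserves
  where
  t : Fin 3 → Fin _
  t = lookup (u ∷ v ∷ w ∷ [])
  R : Fin 3 → Fin 3 → Fin 3 → Set
  R i j l = edge G (f (t i)) (f (t j)) (f (t l)) ≡ true
  R-on-uvw : ∀ {i j l} → Distinct3 i j l → R i j l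
  R-on-uvw = fromOrderedParts (λ i → i) R (trans (sym (sym₁₂ G _ _ _))) (trans (sym (sym₂₃ G _ _ _)))
    (λ { refl refl refl → e-uvw })
  ∈uvw : Fin _ → Bool
  ∈uvw x = not (x ≠ᵇ u) ∨ not (x ≠ᵇ v) ∨ not (x ≠ᵇ w)
  preserves : EdgePreserving (addEdge H u v w) G f
  preserves a b c d e with edge H a b c in eH
  ... | true = f-edges a b c d eH
  ... | false
    with i , refl ← ∈-triple {u = u} {v} {w} {a} (∧-conicalˡ (∈uvw a) _ e)
       | j , refl ← ∈-triple {u = u} {v} {w} {b} (∧-conicalˡ (∈uvw b) _ (∧-conicalʳ (∈uvw a) _ e))
       | l , refl ← ∈-triple {u = u} {v} {w} {c} (∧-conicalʳ (∈uvw b) _ (∧-conicalʳ (∈uvw a) _ e))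
       = R-on-uvw {i} {j} {l} (Distinct3-unmap t d)

Knnn-edge⇒Distinct3 : ∀ {n} {a b c : Fin 3 × Fin n} → edge (Knnn n) a b c ≡ true →
  Distinct3 (proj₁ a) (proj₁ b) (proj₁ c)
Knnn-edge⇒Distinct3 {a = p , _} {q , _} {s , _} e with p ≟ q | q ≟ s | p ≟ s
... | no p≢q | no q≢s | no p≢s = p≢q , q≢s , p≢s
Knnn-edge⇒Distinct3 {a = p , _} {q , _} {s , _} () | yes _ | _     | _
Knnn-edge⇒Distinct3 {a = p , _} {q , _} {s , _} () | no _  | yes _ | _
Knnn-edge⇒Distinct3 {a = p , _} {q , _} {s , _} () | no _  | no _  | yes _

module _ {N n : ℕ} (G : 3Graph (Fin N)) (T : Fin 3 → Fin n → Fin N)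
  (T-injective : ∀ p → Injective _≡_ _≡_ (T p))
  (T-disjoint : ∀ {p q} → p ≢ q → ∀ i j → T p i ≢ T q j)
  (no-edge : ∀ i j l → edge G (T 0F i) (T 1F j) (T 2F l) ≡ false) where

  Knnn-in-complement : Contains (complement G) (Knnn n)
  Knnn-in-complement = κ , κ-injective , λ a b c _ e → κ-edge (Knnn-edge⇒Distinct3 {a = a} {b} {c} e)
    where
    κ : Fin 3 × Fin n → Fin N
    κ (p , i) = T p i
    κ-injective : Injective _≡_ _≡_ κ
    κ-injective {p , i} {q , j} eq with p ≟ q
    ... | yes refl = cong (p ,_) (T-injective p eq)
    ... | no p≢q   = ⊥-elim (T-disjoint p≢q i j eq)
    R : (a b c : Fin 3 × Fin n) → Set
    R a b c = edge (complement G) (κ a) (κ b) (κ c) ≡ true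
    κ-edge : ∀ {a b c} → Distinct3 (proj₁ a) (proj₁ b) (proj₁ c) → R a b c
    κ-edge = fromOrderedParts proj₁ R (trans (sym (sym₁₂ (complement G) _ _ _)))
      (trans (sym (sym₂₃ (complement G) _ _ _)))
      (λ { {_ , i} {_ , j} {_ , l} refl refl refl → cong not (no-edge i j l) })

HasEdge : {W : Set} → 3Graph W → Set
HasEdge K = ∃ λ a → ∃ λ b → ∃ λ c → Distinct3 a b c × edge K a b c ≡ true

Knnn-has-edge : ∀ {n} → 1 ≤ n → HasEdge (Knnn n)
Knnn-has-edge {suc _} _ = (0F , zero) , (1F , zero) , (2F , zero) , ((λ ()) , (λ ()) , (λ ())) , refl

complete : {V : Set} → 3Graph V
complete = record { edge = λ _ _ _ → true ; sym₁₂ = λ _ _ _ → refl ; sym₂₃ = λ _ _ _ → refl }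

Arrows⇒≤ : ∀ {h r} {W : Set} {H : 3Graph (Fin h)} {K : 3Graph W} →
  HasEdge K → Arrows r H K → h ≤ r
Arrows⇒≤ (a , b , c , d , e) arrows with arrows complete
... | inj₁ (_ , φ-injective , _) = injective⇒≤ φ-injective
... | inj₂ (_ , _ , κ-edges)     with () ← κ-edges a b c d e

-- Counting

𝟙 : {A : Set} → Dec A → ℕ
𝟙 a? = if does a? then 1 else 0

𝟙-yes : {A : Set} (a? : Dec A) → A → 𝟙 a? ≡ 1
𝟙-yes a? a rewrite dec-true a? a = refl

𝟙-no : {A : Set} (a? : Dec A) → ¬ A → 𝟙 a? ≡ 0
𝟙-no a? ¬a rewrite dec-false a? ¬a = refl

𝟙≤1 : {A : Set} (a? : Dec A) → 𝟙 a? ≤ 1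
𝟙≤1 (yes _) = s≤s z≤n
𝟙≤1 (no _)  = z≤n

𝟙-mono : {A B : Set} → (A → B) → (a? : Dec A) (b? : Dec B) → 𝟙 a? ≤ 𝟙 b?
𝟙-mono A→B (yes a) b? = ≤-reflexive (sym (𝟙-yes b? (A→B a)))
𝟙-mono A→B (no _)  b? = z≤n

𝟙-cong : {A B : Set} → A ⇔ B → (a? : Dec A) (b? : Dec B) → 𝟙 a? ≡ 𝟙 b?
𝟙-cong A⇔B a? b? = cong (λ x → if x then 1 else 0) (does-⇔ A⇔B a? b?)

𝟙-× : {A B : Set} (a? : Dec A) (b? : Dec B) → 𝟙 (a? ×-dec b?) ≡ 𝟙 a? * 𝟙 b?
𝟙-× (yes _) b? = sym (+-identityʳ (𝟙 b?))
𝟙-× (no _)  b? = refl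

𝟙+𝟙¬ : {A : Set} (a? : Dec A) → 𝟙 a? + 𝟙 (¬? a?) ≡ 1
𝟙+𝟙¬ (yes _) = refl
𝟙+𝟙¬ (no _)  = refl

sum-mono-≤ : ∀ {n} {f g : Fin n → ℕ} → (∀ i → f i ≤ g i) → sum f ≤ sum g
sum-mono-≤ {zero}  _   = z≤n
sum-mono-≤ {suc n} f≤g = +-mono-≤ (f≤g zero) (sum-mono-≤ (f≤g ∘ suc))

sum-const : ∀ n c → ∑[ i < n ] c ≡ n * c
sum-const zero    c = refl
sum-const (suc n) c = cong (c +_) (sum-const n c)

sum-≥-term : ∀ {n} (f : Fin n → ℕ) i → f i ≤ sum f
sum-≥-term {suc n} f i = ≤-trans (m≤m+n (f i) _) (≤-reflexive (sym (sum-remove {i = i} f)))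

∑∑∑-* : ∀ {n} (A B C : Fin n → ℕ) →
  ∑[ a < n ] ∑[ b < n ] ∑[ c < n ] (A a * B b * C c) ≡ sum A * sum B * sum C
∑∑∑-* {n} A B C = begin
  ∑[ a < n ] ∑[ b < n ] ∑[ c < n ] (A a * B b * C c)
    ≡⟨ sum-cong-≗ (λ a → sum-cong-≗ λ b → *-distribˡ-sum (A a * B b) C) ⟨
  ∑[ a < n ] ∑[ b < n ] (A a * B b * sum C)
    ≡⟨ sum-cong-≗ (λ a → *-distribʳ-sum (sum C) (λ b → A a * B b)) ⟨
  ∑[ a < n ] (∑[ b < n ] (A a * B b) * sum C)
    ≡⟨ sum-cong-≗ (λ a → cong (_* sum C) (*-distribˡ-sum (A a) B)) ⟨
  ∑[ a < n ] (A a * sum B * sum C)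
    ≡⟨ *-distribʳ-sum (sum C) (λ a → A a * sum B) ⟨
  ∑[ a < n ] (A a * sum B) * sum C
    ≡⟨ cong (_* sum C) (*-distribʳ-sum (sum B) A) ⟨
  sum A * sum B * sum C ∎
  where open ≡-Reasoning

module _ {M : ℕ} where

  count : {P : Pred (Fin M) 0ℓ} → Decidable P → ℕ
  count P? = ∑[ x < M ] 𝟙 (P? x)

  count≤ : {P : Pred (Fin M) 0ℓ} (P? : Decidable P) → count P? ≤ M
  count≤ P? = ≤-trans (sum-mono-≤ (𝟙≤1 ∘ P?)) (≤-reflexive (trans (sum-const M 1) (*-identityʳ M)))

  count-complement : {P : Pred (Fin M) 0ℓ} (P? : Decidable P) → count P? + count (¬? ∘ P?) ≡ M
  count-complement P? = begin
    count P? + count (¬? ∘ P?)             ≡⟨ ∑-distrib-+ (𝟙 ∘ P?) (𝟙 ∘ ¬? ∘ P?) ⟨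
    ∑[ x < M ] (𝟙 (P? x) + 𝟙 (¬? (P? x))) ≡⟨ sum-cong-≗ (𝟙+𝟙¬ ∘ P?) ⟩
    ∑[ x < M ] 1                           ≡⟨ trans (sum-const M 1) (*-identityʳ M) ⟩
    M                                      ∎
    where open ≡-Reasoning

  _∖?_ : {P Q : Pred (Fin M) 0ℓ} → Decidable P → Decidable Q → Decidable (λ x → P x × ¬ Q x)
  (P? ∖? Q?) x = P? x ×-dec ¬? (Q? x)

  count-∖ : {P Q : Pred (Fin M) 0ℓ} (P? : Decidable P) (Q? : Decidable Q) →
    count P? ≤ count (P? ∖? Q?) + count Q?
  count-∖ P? Q? = ≤-trans (sum-mono-≤ λ x → split (P? x) (Q? x))
    (≤-reflexive (∑-distrib-+ (𝟙 ∘ (P? ∖? Q?)) (𝟙 ∘ Q?)))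
    where
    split : {A B : Set} (a? : Dec A) (b? : Dec B) → 𝟙 a? ≤ 𝟙 (a? ×-dec ¬? b?) + 𝟙 b?
    split (yes _) (yes _) = s≤s z≤n
    split (yes _) (no _)  = s≤s z≤n
    split (no _)  b?      = z≤n

  count-∖≥ : {P Q : Pred (Fin M) 0ℓ} (P? : Decidable P) (Q? : Decidable Q) {n : ℕ} →
    n + count Q? ≤ count P? → n ≤ count (P? ∖? Q?)
  count-∖≥ P? Q? {n} le = +-cancelʳ-≤ (count Q?) n _ (≤-trans le (count-∖ P? Q?))

  Selection : Pred (Fin M) 0ℓ → ℕ → Set
  Selection P n = ∃ λ (φ : Fin n → Fin M) → Injective _≡_ _≡_ φ × (∀ i → P (φ i))

pick : ∀ {M} {P : Pred (Fin M) 0ℓ} (P? : Decidable P) n → n ≤ count P? → Selection P n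
pick P? zero _ = (λ ()) , (λ { {()} }) , λ ()
pick {suc M} P? (suc n) n<count with P? zero
... | yes P0 with φ , φ-injective , φ∈P ← pick (P? ∘ suc) n (≤-pred n<count) =
  zero ∷ᶠ suc ∘ φ ,
  (λ { {zero} {zero} _ → refl ; {suc i} {suc j} e → cong suc (φ-injective (suc-injective e)) }) ,
  λ { zero → P0 ; (suc i) → φ∈P i }
... | no _ with φ , φ-injective , φ∈P ← pick (P? ∘ suc) (suc n) n<count =
  suc ∘ φ , φ-injective ∘ suc-injective , φ∈P

module _ {h M : ℕ} where

  Image : (Fin h → Fin M) → Pred (Fin M) 0ℓ
  Image φ x = ∃ λ i → φ i ≡ x

  image? : (φ : Fin h → Fin M) → Decidable (Image φ)
  image? φ x = any? λ i → φ i ≟ x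

outside-image-∷ : ∀ {h M} (φ : Fin (suc h) → Fin M) {x} → φ zero ≢ x →
  (¬ Image φ x) ⇔ (¬ Image (φ ∘ suc) x)
outside-image-∷ φ φ0≢x = mk⇔ (λ ∉φ (i , e) → ∉φ (suc i , e))
  λ { ∉ψ (zero , e) → φ0≢x e ; ∉ψ (suc i , e) → ∉ψ (i , e) }

count-outside-image : ∀ {h M} (φ : Fin h → Fin M) → Injective _≡_ _≡_ φ →
  count (¬? ∘ image? φ) + h ≡ M
count-outside-image {zero} {M} φ _ = begin
  count (¬? ∘ image? φ) + 0       ≡⟨ +-identityʳ _ ⟩
  ∑[ x < M ] 𝟙 (¬? (image? φ x)) ≡⟨ sum-cong-≗ (λ x → 𝟙-yes (¬? (image? φ x)) λ ()) ⟩
  ∑[ x < M ] 1                    ≡⟨ trans (sum-const M 1) (*-identityʳ M) ⟩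
  M                               ∎
  where open ≡-Reasoning
count-outside-image {suc h} {zero} φ _ with () ← φ zero
count-outside-image {suc h} {suc M} φ φ-injective = begin
  count (¬? ∘ image? φ) + suc h
    ≡⟨ cong (_+ suc h) (sum-remove {i = y} (𝟙 ∘ ¬? ∘ image? φ)) ⟩
  𝟙 (¬? (image? φ y)) + tail-sum φ + suc h
    ≡⟨ cong (λ z → z + tail-sum φ + suc h) (𝟙-no (¬? (image? φ y)) (λ y∉ → y∉ (zero , refl))) ⟩
  tail-sum φ + suc h
    ≡⟨ cong (_+ suc h) (sum-cong-≗ λ z →
         𝟙-cong (outside-image-∷ φ (punchInᵢ≢i y z ∘ sym)) (¬? (image? φ _)) (¬? (image? ψ _))) ⟩
  tail-sum ψ + suc h
    ≡⟨ +-suc (tail-sum ψ) h ⟩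
  suc (tail-sum ψ) + h
    ≡⟨ cong (λ z → z + tail-sum ψ + h) (𝟙-yes (¬? (image? ψ y)) y∉ψ) ⟨
  𝟙 (¬? (image? ψ y)) + tail-sum ψ + h
    ≡⟨ cong (_+ h) (sum-remove {i = y} (𝟙 ∘ ¬? ∘ image? ψ)) ⟨
  count (¬? ∘ image? ψ) + h
    ≡⟨ count-outside-image ψ (suc-injective ∘ φ-injective) ⟩
  suc M ∎
  where
  open ≡-Reasoning
  y : Fin (suc M)
  y = φ zero
  ψ : Fin h → Fin (suc M)
  ψ = φ ∘ suc
  tail-sum : ∀ {k} → (Fin k → Fin (suc M)) → ℕ
  tail-sum χ = ∑[ z < M ] 𝟙 (¬? (image? χ (punchIn y z)))
  y∉ψ : ¬ Image ψ y
  y∉ψ (i , ψi≡y) with () ← φ-injective ψi≡y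

count-image : ∀ {h M} (φ : Fin h → Fin M) → Injective _≡_ _≡_ φ → count (image? φ) ≡ h
count-image {h} {M} φ φ-injective = +-cancelˡ-≡ (count (¬? ∘ image? φ)) _ _ (begin
  count (¬? ∘ image? φ) + count (image? φ) ≡⟨ +-comm _ (count (image? φ)) ⟩
  count (image? φ) + count (¬? ∘ image? φ) ≡⟨ count-complement (image? φ) ⟩
  M                                        ≡⟨ count-outside-image φ φ-injective ⟨
  count (¬? ∘ image? φ) + h                ∎)
  where open ≡-Reasoning

∑Vec : ∀ k m → (Vec (Fin m) k → ℕ) → ℕ
∑Vec zero    m F = F []
∑Vec (suc k) m F = ∑[ y < m ] ∑Vec k m (λ g → F (y ∷ g))

module _ {m : ℕ} where

  ∑Vec-cong : ∀ k {F F′ : Vec (Fin m) k → ℕ} → (∀ f → F f ≡ F′ f) → ∑Vec k m F ≡ ∑Vec k m F′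
  ∑Vec-cong zero    F≡F′ = F≡F′ []
  ∑Vec-cong (suc k) F≡F′ = sum-cong-≗ λ y → ∑Vec-cong k (F≡F′ ∘ (y ∷_))

  ∑Vec-mono-≤ : ∀ k {F F′ : Vec (Fin m) k → ℕ} → (∀ f → F f ≤ F′ f) → ∑Vec k m F ≤ ∑Vec k m F′
  ∑Vec-mono-≤ zero    F≤F′ = F≤F′ []
  ∑Vec-mono-≤ (suc k) F≤F′ = sum-mono-≤ λ y → ∑Vec-mono-≤ k (F≤F′ ∘ (y ∷_))

  ∑Vec-≥-term : ∀ k (F : Vec (Fin m) k → ℕ) f → F f ≤ ∑Vec k m F
  ∑Vec-≥-term zero    F []      = ≤-refl
  ∑Vec-≥-term (suc k) F (y ∷ g) =
    ≤-trans (∑Vec-≥-term k (F ∘ (y ∷_)) g) (sum-≥-term (λ y → ∑Vec k m (F ∘ (y ∷_))) y)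

  ∑Vec-*ˡ : ∀ k c (F : Vec (Fin m) k → ℕ) → ∑Vec k m (λ f → c * F f) ≡ c * ∑Vec k m F
  ∑Vec-*ˡ zero    c F = refl
  ∑Vec-*ˡ (suc k) c F = trans (sum-cong-≗ λ y → ∑Vec-*ˡ k c (F ∘ (y ∷_)))
    (sym (*-distribˡ-sum c (λ y → ∑Vec k m (F ∘ (y ∷_)))))

  ∑Vec-const : ∀ k c → ∑Vec k m (λ _ → c) ≡ m ^ k * c
  ∑Vec-const zero    c = sym (+-identityʳ c)
  ∑Vec-const (suc k) c = begin
    ∑[ y < m ] ∑Vec k m (λ _ → c) ≡⟨ sum-cong-≗ {m} (λ _ → ∑Vec-const k c) ⟩
    ∑[ y < m ] (m ^ k * c)        ≡⟨ sum-const m (m ^ k * c) ⟩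
    m * (m ^ k * c)               ≡⟨ *-assoc m (m ^ k) c ⟨
    m * m ^ k * c                 ∎
    where open ≡-Reasoning

  ∑Vec-∑-comm : ∀ k {j} (Φ : Vec (Fin m) k → Fin j → ℕ) →
    ∑Vec k m (λ f → ∑[ x < j ] Φ f x) ≡ ∑[ x < j ] ∑Vec k m (λ f → Φ f x)
  ∑Vec-∑-comm zero    Φ = refl
  ∑Vec-∑-comm (suc k) Φ = trans (sum-cong-≗ λ y → ∑Vec-∑-comm k (Φ ∘ (y ∷_)))
    (∑-comm (λ y x → ∑Vec k m (λ g → Φ (y ∷ g) x)))

∑Vec-map-punchIn : ∀ k {m} (x : Fin (suc m)) (F : Vec (Fin (suc m)) k → ℕ) →
  ∑Vec k m (F ∘ map (punchIn x)) ≡ ∑Vec k (suc m) (λ f → 𝟙 (¬? (image? (lookup f) x)) * F f)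
∑Vec-map-punchIn zero    x F = sym (+-identityʳ (F []))
∑Vec-map-punchIn (suc k) {m} x F = begin
  ∑[ y < m ] ∑Vec k m (λ g → F (punchIn x y ∷ map (punchIn x) g))
    ≡⟨ sum-cong-≗ (λ y → ∑Vec-map-punchIn k x (F ∘ (punchIn x y ∷_))) ⟩
  ∑[ y < m ] ∑Vec k (suc m) (λ f → 𝟙 (∉? f) * F (punchIn x y ∷ f))
    ≡⟨ sum-cong-≗ (λ y → ∑Vec-cong k λ f → cong (_* F (punchIn x y ∷ f))
         (sym (𝟙-cong (outside-image-∷ (lookup (punchIn x y ∷ f)) (punchInᵢ≢i x y))
                      (∉? (punchIn x y ∷ f)) (∉? f)))) ⟩
  ∑[ y < m ] T (punchIn x y)
    ≡⟨ cong (_+ ∑[ y < m ] T (punchIn x y)) T[x]≡0 ⟨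
  T x + ∑[ y < m ] T (punchIn x y)
    ≡⟨ sum-remove {i = x} T ⟨
  ∑[ z < suc m ] T z ∎
  where
  open ≡-Reasoning
  ∉? : ∀ {l} (f : Vec (Fin (suc m)) l) → Dec (¬ Image (lookup f) x)
  ∉? f = ¬? (image? (lookup f) x)
  T : Fin (suc m) → ℕ
  T z = ∑Vec k (suc m) (λ f → 𝟙 (∉? (z ∷ f)) * F (z ∷ f))
  T[x]≡0 : T x ≡ 0
  T[x]≡0 = begin
    T x
      ≡⟨ ∑Vec-cong k (λ f → cong (_* F (x ∷ f)) (𝟙-no (∉? (x ∷ f)) λ x∉ → x∉ (zero , refl))) ⟩
    ∑Vec k (suc m) (λ _ → 0) ≡⟨ ∑Vec-const k 0 ⟩
    suc m ^ k * 0            ≡⟨ *-zeroʳ (suc m ^ k) ⟩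
    0                        ∎

⊎-choice : ∀ {n} {A B : Fin n → Set} → (∀ x → A x ⊎ B x) → ∃ A ⊎ (∀ x → B x)
⊎-choice {zero}  _   = inj₂ λ ()
⊎-choice {suc n} A⊎B with A⊎B zero | ⊎-choice (A⊎B ∘ suc)
... | inj₁ a | _            = inj₁ (zero , a)
... | inj₂ _ | inj₁ (x , a) = inj₁ (suc x , a)
... | inj₂ b | inj₂ bs      = inj₂ λ { zero → b ; (suc x) → bs x }

⊎-choiceⱽ : ∀ k {m} {A B : Vec (Fin m) k → Set} → (∀ g → A g ⊎ B g) → ∃ A ⊎ (∀ g → B g)
⊎-choiceⱽ zero A⊎B with A⊎B []
... | inj₁ a = inj₁ ([] , a)
... | inj₂ b = inj₂ λ { [] → b }
⊎-choiceⱽ (suc k) A⊎B with ⊎-choice (λ y → ⊎-choiceⱽ k (A⊎B ∘ (y ∷_)))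
... | inj₁ (y , g , a) = inj₁ (y ∷ g , a)
... | inj₂ bs          = inj₂ λ { (y ∷ g) → bs y g }

-- Supersaturation

#embeddings : ∀ {h m} → 3Graph (Fin h) → 3Graph (Fin m) → ℕ
#embeddings {h} {m} H G = ∑Vec h m λ f → 𝟙 (isEmbedding? H G (lookup f))

Contains⇒#embeddings-pos : ∀ {h m} {H : 3Graph (Fin h)} {G : 3Graph (Fin m)} →
  Contains G H → 1 ≤ #embeddings H G
Contains⇒#embeddings-pos {h} {m} {H} {G} (φ , φ-emb) = begin
  1                               ≡⟨ 𝟙-yes (isEmbedding? H G (lookup f)) f-emb ⟨
  𝟙 (isEmbedding? H G (lookup f)) ≤⟨ ∑Vec-≥-term h (λ f → 𝟙 (isEmbedding? H G (lookup f))) f ⟩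
  #embeddings H G                 ∎
  where
  open ≤-Reasoning
  f : Vec (Fin m) h
  f = tabulate φ
  f-emb : IsEmbedding H G (lookup f)
  f-emb = IsEmbedding-resp-≗ {H = H} {G = G} (sym ∘ lookup∘tabulate φ) φ-emb

#embeddings-delete : ∀ {h m} (H : 3Graph (Fin h)) (G : 3Graph (Fin (suc m))) →
  ∑[ x < suc m ] #embeddings H (pullback (punchIn x) G) ≡ (suc m ∸ h) * #embeddings H G
#embeddings-delete {h} {m} H G = begin
  ∑[ x < suc m ] ∑Vec h m (λ g → 𝟙 (isEmbedding? H (pullback (punchIn x) G) (lookup g)))
    ≡⟨ sum-cong-≗ (λ x → ∑Vec-cong h λ g → 𝟙-cong (embedding-after-punchIn x g)
         (isEmbedding? H (pullback (punchIn x) G) (lookup g))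
         (isEmbedding? H G (lookup (map (punchIn x) g)))) ⟩
  ∑[ x < suc m ] ∑Vec h m (λ g → emb (map (punchIn x) g))
    ≡⟨ sum-cong-≗ (λ x → ∑Vec-map-punchIn h x emb) ⟩
  ∑[ x < suc m ] ∑Vec h (suc m) (λ f → 𝟙 (¬? (image? (lookup f) x)) * emb f)
    ≡⟨ ∑Vec-∑-comm h (λ f x → 𝟙 (¬? (image? (lookup f) x)) * emb f) ⟨
  ∑Vec h (suc m) (λ f → ∑[ x < suc m ] (𝟙 (¬? (image? (lookup f) x)) * emb f))
    ≡⟨ ∑Vec-cong h avoided-by-embedding ⟩
  ∑Vec h (suc m) (λ f → (suc m ∸ h) * emb f)
    ≡⟨ ∑Vec-*ˡ h (suc m ∸ h) emb ⟩
  (suc m ∸ h) * #embeddings H G ∎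
  where
  open ≡-Reasoning
  emb : Vec (Fin (suc m)) h → ℕ
  emb f = 𝟙 (isEmbedding? H G (lookup f))
  embedding-after-punchIn : ∀ x g →
    IsEmbedding H (pullback (punchIn x) G) (lookup g) ⇔ IsEmbedding H G (lookup (map (punchIn x) g))
  embedding-after-punchIn x g = mk⇔
    (IsEmbedding-resp-≗ {H = H} {G = G} (λ i → sym (lookup-map i (punchIn x) g))
      ∘ Equivalence.to pullback⇔)
    (Equivalence.from pullback⇔ ∘ IsEmbedding-resp-≗ {H = H} {G = G} (λ i → lookup-map i (punchIn x) g))
    where
    pullback⇔ : IsEmbedding H (pullback (punchIn x) G) (lookup g) ⇔
                IsEmbedding H G (punchIn x ∘ lookup g)
    pullback⇔ = IsEmbedding-pullback {H = H} {G = G} (punchIn-injective x _ _)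
  avoided-by-embedding : ∀ f →
    ∑[ x < suc m ] (𝟙 (¬? (image? (lookup f) x)) * emb f) ≡ (suc m ∸ h) * emb f
  avoided-by-embedding f = begin
    ∑[ x < suc m ] (𝟙 (¬? (image? (lookup f) x)) * emb f)
      ≡⟨ *-distribʳ-sum (emb f) (𝟙 ∘ ¬? ∘ image? (lookup f)) ⟨
    count (¬? ∘ image? (lookup f)) * emb f
      ≡⟨ scaled (isEmbedding? H G (lookup f)) ⟩
    (suc m ∸ h) * emb f ∎
    where
    scaled : (e? : Dec (IsEmbedding H G (lookup f))) →
      count (¬? ∘ image? (lookup f)) * 𝟙 e? ≡ (suc m ∸ h) * 𝟙 e?
    scaled (yes (f-injective , _)) = cong (_* 1) (begin
      count (¬? ∘ image? (lookup f))         ≡⟨ m+n∸n≡m _ h ⟨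
      count (¬? ∘ image? (lookup f)) + h ∸ h
        ≡⟨ cong (_∸ h) (count-outside-image (lookup f) f-injective) ⟩
      suc m ∸ h                              ∎)
    scaled (no _) = trans (*-zeroʳ (count (¬? ∘ image? (lookup f)))) (sym (*-zeroʳ (suc m ∸ h)))

P′-suc : ∀ m h → suc m * (m P′ h) ≡ (suc m ∸ h) * (suc m P′ h)
P′-suc m zero    = refl
P′-suc m (suc h) = begin
  suc m * ((m ∸ h) * (m P′ h))           ≡⟨ x[yz]≡y[xz] (suc m) (m ∸ h) (m P′ h) ⟩
  (m ∸ h) * (suc m * (m P′ h))           ≡⟨ cong ((m ∸ h) *_) (P′-suc m h) ⟩
  (m ∸ h) * ((suc m ∸ h) * (suc m P′ h)) ∎
  where
  open ≡-Reasoning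
  x[yz]≡y[xz] : ∀ x y z → x * (y * z) ≡ y * (x * z)
  x[yz]≡y[xz] = solve-∀

P′-pos : ∀ {m h} → h ≤ m → 0 < m P′ h
P′-pos {h = zero}  _   = s≤s z≤n
P′-pos {h = suc h} h<m = *-mono-< (m<n⇒0<n∸m h<m) (P′-pos (≤-trans (n≤1+n h) h<m))

^*P′≤P′*^ : ∀ {r N} h → r ≤ N → N ^ h * (r P′ h) ≤ (N P′ h) * r ^ h
^*P′≤P′*^ zero    _   = ≤-refl
^*P′≤P′*^ {r} {N} (suc h) r≤N = begin
  N * N ^ h * ((r ∸ h) * (r P′ h)) ≡⟨ regroup N (N ^ h) (r ∸ h) (r P′ h) ⟩
  N ^ h * (r P′ h) * ((r ∸ h) * N) ≤⟨ *-mono-≤ (^*P′≤P′*^ h r≤N) factor≤ ⟩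
  (N P′ h) * r ^ h * ((N ∸ h) * r) ≡⟨ regroup′ (N P′ h) (r ^ h) (N ∸ h) r ⟩
  (N ∸ h) * (N P′ h) * (r * r ^ h) ∎
  where
  open ≤-Reasoning
  regroup : ∀ a b c d → a * b * (c * d) ≡ b * d * (c * a)
  regroup = solve-∀
  regroup′ : ∀ a b c d → a * b * (c * d) ≡ c * a * (d * b)
  regroup′ = solve-∀
  factor≤ : (r ∸ h) * N ≤ (N ∸ h) * r
  factor≤ = begin
    (r ∸ h) * N   ≡⟨ *-distribʳ-∸ N r h ⟩
    r * N ∸ h * N ≤⟨ ∸-monoʳ-≤ (r * N) (*-monoʳ-≤ h r≤N) ⟩
    r * N ∸ h * r ≡⟨ cong (_∸ h * r) (*-comm r N) ⟩
    N * r ∸ h * r ≡⟨ *-distribʳ-∸ r N h ⟨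
    (N ∸ h) * r   ∎

supersaturation : ∀ {h r} {W : Set} {H : 3Graph (Fin h)} {K : 3Graph W} → h ≤ r → Arrows r H K →
  ∀ {m} → r ≤′ m → (G : 3Graph (Fin m)) →
  Contains (complement G) K ⊎ m P′ h ≤ #embeddings H G * (r P′ h)
supersaturation {h} {r} {H = H} h≤r arrows ≤′-refl G with arrows G
... | inj₁ H⊆G  = inj₂ (≤-trans (≤-reflexive (sym (*-identityˡ (r P′ h))))
                               (*-monoˡ-≤ (r P′ h) (Contains⇒#embeddings-pos {H = H} {G} H⊆G)))
... | inj₂ K⊆Gᶜ = inj₁ K⊆Gᶜ
supersaturation {h} {r} {H = H} {K} h≤r arrows {suc m} (≤′-step r≤′m) G
  with ⊎-choice (λ x → supersaturation {H = H} {K} h≤r arrows r≤′m (pullback (punchIn x) G))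
... | inj₁ (x , K⊆[G-x]ᶜ) =
  inj₁ (Contains-pullback {K = K} {complement G} {punchIn x} (punchIn-injective x _ _) K⊆[G-x]ᶜ)
... | inj₂ bounds = inj₂ (*-cancelˡ-≤ (suc m ∸ h) {{>-nonZero (m<n⇒0<n∸m h<1+m)}} (begin
  (suc m ∸ h) * (suc m P′ h)                        ≡⟨ P′-suc m h ⟨
  suc m * (m P′ h)                                  ≡⟨ sum-const (suc m) (m P′ h) ⟨
  ∑[ x < suc m ] (m P′ h)                           ≤⟨ sum-mono-≤ bounds ⟩
  ∑[ x < suc m ] (#embeddings H (G - x) * (r P′ h))
    ≡⟨ *-distribʳ-sum (r P′ h) (λ x → #embeddings H (G - x)) ⟨
  (∑[ x < suc m ] #embeddings H (G - x)) * (r P′ h) ≡⟨ cong (_* (r P′ h)) (#embeddings-delete H G) ⟩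
  (suc m ∸ h) * #embeddings H G * (r P′ h)          ≡⟨ *-assoc (suc m ∸ h) _ _ ⟩
  (suc m ∸ h) * (#embeddings H G * (r P′ h))        ∎))
  where
  open ≤-Reasoning
  _-_ : 3Graph (Fin (suc m)) → Fin (suc m) → 3Graph (Fin m)
  G - x = pullback (punchIn x) G
  h<1+m : h < suc m
  h<1+m = s≤s (≤-trans h≤r (≤′⇒≤ r≤′m))

-- Splitting H₀ at its vertices 0, 1, 2

module _ {k : ℕ} where

  data Position : Fin (3 + k) → Set where
    triple : (j : Fin 3) → Position (j ↑ˡ k)
    other  : (i : Fin k) → Position (3 ↑ʳ i)

  position : (x : Fin (3 + k)) → Position x
  position 0F                  = triple 0F
  position 1F                  = triple 1F
  position 2F                  = triple 2F
  position (suc (suc (suc i))) = other i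

  slot : Fin 3 → Fin (suc k) → Fin (3 + k)
  slot j zero    = j ↑ˡ k
  slot j (suc i) = 3 ↑ʳ i

  slot-injective : ∀ j → Injective _≡_ _≡_ (slot j)
  slot-injective j  {zero}  {zero}   _ = refl
  slot-injective j  {suc i} {suc i′} e = cong suc (↑ʳ-injective 3 i i′ e)
  slot-injective 0F {zero}  {suc _}  ()
  slot-injective 1F {zero}  {suc _}  ()
  slot-injective 2F {zero}  {suc _}  ()
  slot-injective 0F {suc _} {zero}   ()
  slot-injective 1F {suc _} {zero}   ()
  slot-injective 2F {suc _} {zero}   ()

  rest : 3Graph (Fin (3 + k)) → 3Graph (Fin k)
  rest = pullback (3 ↑ʳ_)

  rest+ : Fin 3 → 3Graph (Fin (3 + k)) → 3Graph (Fin (suc k))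
  rest+ j = pullback (slot j)

  EmbeddingOntoEdge : {V : Set} → 3Graph (Fin (3 + k)) → 3Graph V → Set
  EmbeddingOntoEdge H₀ G = ∃ λ F → IsEmbedding H₀ G F × edge G (F 0F) (F 1F) (F 2F) ≡ true

  Candidate : {V : Set} → 3Graph (Fin (3 + k)) → 3Graph V → Fin 3 → (Fin k → V) → V → Set
  Candidate H₀ G j ρ x = IsEmbedding (rest+ j H₀) G (x ∷ᶠ ρ)

  IsEmbedding-split : {V : Set} {H₀ : 3Graph (Fin (3 + k))} {G : 3Graph V} {F : Fin (3 + k) → V} →
    IsEmbedding H₀ G F →
    IsEmbedding (rest H₀) G (F ∘ (3 ↑ʳ_)) × (∀ j → Candidate H₀ G j (F ∘ (3 ↑ʳ_)) (F (j ↑ˡ k)))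
  IsEmbedding-split {H₀ = H₀} {G} {F} F-emb =
    IsEmbedding-restrict {H = H₀} {G = G} (↑ʳ-injective 3 _ _) F-emb ,
    λ j → IsEmbedding-resp-≗ {H = rest+ j H₀} {G = G} (λ { zero → refl ; (suc i) → refl })
      (IsEmbedding-restrict {H = H₀} {G = G} (slot-injective j) F-emb)

  swap-pairFree : {H₀ : 3Graph (Fin (3 + k))} {a b : Fin (3 + k)} →
    (∀ c → Distinct3 a b c → edge H₀ a b c ≡ false) → ∀ c → Distinct3 b a c → edge H₀ b a c ≡ false
  swap-pairFree {H₀} free c d = trans (sym₁₂ H₀ _ _ c) (free c (Distinct3-swap₁₂ d))

  pairFree-anyOrder : {H₀ : 3Graph (Fin (3 + k))} → PairFree H₀ 0F 1F 2F →
    ∀ j j′ c → Distinct3 (j ↑ˡ k) (j′ ↑ˡ k) c → edge H₀ (j ↑ˡ k) (j′ ↑ˡ k) c ≡ false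
  pairFree-anyOrder (free₀₁ , _ , _) 0F 1F = free₀₁
  pairFree-anyOrder (_ , free₀₂ , _) 0F 2F = free₀₂
  pairFree-anyOrder (_ , _ , free₁₂) 1F 2F = free₁₂
  pairFree-anyOrder {H₀} (free₀₁ , _ , _) 1F 0F = swap-pairFree {H₀ = H₀} free₀₁
  pairFree-anyOrder {H₀} (_ , free₀₂ , _) 2F 0F = swap-pairFree {H₀ = H₀} free₀₂
  pairFree-anyOrder {H₀} (_ , _ , free₁₂) 2F 1F = swap-pairFree {H₀ = H₀} free₁₂
  pairFree-anyOrder _ 0F 0F c (d , _) = ⊥-elim (d refl)
  pairFree-anyOrder _ 1F 1F c (d , _) = ⊥-elim (d refl)
  pairFree-anyOrder _ 2F 2F c (d , _) = ⊥-elim (d refl)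

module _ {k : ℕ} {V : Set} {H₀ : 3Graph (Fin (3 + k))} {G : 3Graph V} (pairFree : PairFree H₀ 0F 1F 2F)
  {τ : Fin 3 → V} (τ-injective : Injective _≡_ _≡_ τ)
  {ρ : Fin k → V} (ρ-emb : IsEmbedding (rest H₀) G ρ)
  (candidates : ∀ j → Candidate H₀ G j ρ (τ j)) where

  IsEmbedding-glue : IsEmbedding H₀ G (τ ++ ρ)
  IsEmbedding-glue = injective , preserving
    where
    F : Fin (3 + k) → V
    F = τ ++ ρ
    F-rest+ : ∀ j → IsEmbedding (rest+ j H₀) G (F ∘ slot j)
    F-rest+ j = IsEmbedding-resp-≗ {H = rest+ j H₀} {G = G}
      (λ { zero → sym (lookup-++ˡ τ ρ j) ; (suc i) → refl }) (candidates j)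
    injective : Injective _≡_ _≡_ F
    injective {x} {y} e with position x | position y
    ... | triple j | triple j′ =
      cong (_↑ˡ k) (τ-injective (trans (sym (lookup-++ˡ τ ρ j)) (trans e (lookup-++ˡ τ ρ j′))))
    ... | triple j | other i  with () ← proj₁ (F-rest+ j) {zero} {suc i} e
    ... | other i  | triple j with () ← proj₁ (F-rest+ j) {suc i} {zero} e
    ... | other i  | other i′ = cong (3 ↑ʳ_) (proj₁ ρ-emb e)
    R : (a b c : Fin (3 + k)) → Set
    R a b c = Distinct3 a b c → edge H₀ a b c ≡ true → edge G (F a) (F b) (F c) ≡ true
    R-swap₁₂ : ∀ {a b c} → R a b c → R b a c
    R-swap₁₂ {a} {b} {c} r d e =
      trans (sym (sym₁₂ G (F a) (F b) (F c))) (r (Distinct3-swap₁₂ d) (trans (sym₁₂ H₀ a b c) e))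
    R-swap₂₃ : ∀ {a b c} → R a b c → R a c b
    R-swap₂₃ {a} {b} {c} r d e =
      trans (sym (sym₂₃ G (F a) (F b) (F c))) (r (Distinct3-swap₂₃ d) (trans (sym₂₃ H₀ a b c) e))
    two-in-triple : ∀ j j′ c → R (j ↑ˡ k) (j′ ↑ˡ k) c
    two-in-triple j j′ c d e with () ← trans (sym e) (pairFree-anyOrder {H₀ = H₀} pairFree j j′ c d)
    one-in-triple : ∀ j i i′ → R (j ↑ˡ k) (3 ↑ʳ i) (3 ↑ʳ i′)
    one-in-triple j i i′ d = proj₂ (F-rest+ j) zero (suc i) (suc i′) (Distinct3-unmap (slot j) d)
    none-in-triple : ∀ i i′ i″ → R (3 ↑ʳ i) (3 ↑ʳ i′) (3 ↑ʳ i″)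
    none-in-triple i i′ i″ d = proj₂ ρ-emb i i′ i″ (Distinct3-unmap (3 ↑ʳ_) d)
    preserving : EdgePreserving H₀ G F
    preserving a b c with position a | position b | position c
    ... | triple j | triple j′ | _         = two-in-triple j j′ c
    ... | triple j | other i   | triple j′ = R-swap₂₃ (two-in-triple j j′ (3 ↑ʳ i))
    ... | other i  | triple j  | triple j′ = R-swap₁₂ (R-swap₂₃ (two-in-triple j j′ (3 ↑ʳ i)))
    ... | triple j | other i   | other i′  = one-in-triple j i i′
    ... | other i  | triple j  | other i′  = R-swap₁₂ (one-in-triple j i i′)
    ... | other i  | other i′  | triple j  = R-swap₂₃ (R-swap₁₂ (one-in-triple j i i′))
    ... | other i  | other i′  | other i″  = none-in-triple i i′ i″

disjoint-families : ∀ {N} n {C : Fin 3 → Pred (Fin N) 0ℓ} (C? : ∀ p → Decidable (C p)) →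
  (∀ p → 3 * n ≤ count (C? p)) →
  ∃ λ (T : Fin 3 → Fin n → Fin N) → (∀ p → Injective _≡_ _≡_ (T p)) ×
    (∀ {p q} → p ≢ q → ∀ i j → T p i ≢ T q j) × (∀ p i → C p (T p i))
disjoint-families {N} n {C} C? large = T , T-injective , T-disjoint , T-in-C
  where
  open ≤-Reasoning
  U-sel : Selection (C 0F) n
  U-sel = pick (C? 0F) n (≤-trans (m≤m+n n (2 * n)) (large 0F))
  U : Fin n → Fin N
  U = proj₁ U-sel
  U-injective : Injective _≡_ _≡_ U
  U-injective = proj₁ (proj₂ U-sel)
  V-sel : Selection (λ x → C 1F x × ¬ Image U x) n
  V-sel = pick (C? 1F ∖? image? U) n (count-∖≥ (C? 1F) (image? U) (begin
    n + count (image? U) ≡⟨ cong (n +_) (count-image U U-injective) ⟩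
    n + n                ≤⟨ +-monoʳ-≤ n (m≤m+n n (n + 0)) ⟩
    3 * n                ≤⟨ large 1F ⟩
    count (C? 1F)        ∎))
  V : Fin n → Fin N
  V = proj₁ V-sel
  V-injective : Injective _≡_ _≡_ V
  V-injective = proj₁ (proj₂ V-sel)
  W-sel : Selection (λ x → (C 2F x × ¬ Image U x) × ¬ Image V x) n
  W-sel = pick ((C? 2F ∖? image? U) ∖? image? V) n
    (count-∖≥ (C? 2F ∖? image? U) (image? V) (count-∖≥ (C? 2F) (image? U) (begin
      n + count (image? V) + count (image? U)
        ≡⟨ cong₂ (λ a b → n + a + b) (count-image V V-injective) (count-image U U-injective) ⟩
      n + n + n     ≡⟨ 3n≡n+n+n n ⟨
      3 * n         ≤⟨ large 2F ⟩
      count (C? 2F) ∎)))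
    where
    3n≡n+n+n : ∀ n → 3 * n ≡ n + n + n
    3n≡n+n+n = solve-∀
  T : Fin 3 → Fin n → Fin N
  T 0F = U
  T 1F = V
  T 2F = proj₁ W-sel
  T-injective : ∀ p → Injective _≡_ _≡_ (T p)
  T-injective 0F = U-injective
  T-injective 1F = V-injective
  T-injective 2F = proj₁ (proj₂ W-sel)
  T-in-C : ∀ p i → C p (T p i)
  T-in-C 0F i = proj₂ (proj₂ U-sel) i
  T-in-C 1F i = proj₁ (proj₂ (proj₂ V-sel) i)
  T-in-C 2F i = proj₁ (proj₁ (proj₂ (proj₂ W-sel) i))
  T-disjoint : ∀ {p q} → p ≢ q → ∀ i j → T p i ≢ T q j
  T-disjoint {0F} {1F} _ i j e = proj₂ (proj₂ (proj₂ V-sel) j) (i , e)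
  T-disjoint {0F} {2F} _ i j e = proj₂ (proj₁ (proj₂ (proj₂ W-sel) j)) (i , e)
  T-disjoint {1F} {2F} _ i j e = proj₂ (proj₂ (proj₂ W-sel) j) (i , e)
  T-disjoint {1F} {0F} _ i j e = T-disjoint {0F} {1F} (λ ()) j i (sym e)
  T-disjoint {2F} {0F} _ i j e = T-disjoint {0F} {2F} (λ ()) j i (sym e)
  T-disjoint {2F} {1F} _ i j e = T-disjoint {1F} {2F} (λ ()) j i (sym e)
  T-disjoint {0F} {0F} p≢q = ⊥-elim (p≢q refl)
  T-disjoint {1F} {1F} p≢q = ⊥-elim (p≢q refl)
  T-disjoint {2F} {2F} p≢q = ⊥-elim (p≢q refl)

product-bound : ∀ {T N} (x : Fin 3 → ℕ) → (∀ j → x j ≤ N) → ∀ j → x j < T →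
  x 0F * x 1F * x 2F ≤ pred T * N * N
product-bound {T} {N} x x≤N 0F x<T = *-mono-≤ (*-mono-≤ (<⇒≤pred x<T) (x≤N 1F)) (x≤N 2F)
product-bound {T} {N} x x≤N 1F x<T = begin
  x 0F * x 1F * x 2F ≤⟨ *-mono-≤ (*-mono-≤ (x≤N 0F) (<⇒≤pred x<T)) (x≤N 2F) ⟩
  N * pred T * N     ≡⟨ cong (_* N) (*-comm N (pred T)) ⟩
  pred T * N * N     ∎
  where open ≤-Reasoning
product-bound {T} {N} x x≤N 2F x<T = begin
  x 0F * x 1F * x 2F ≤⟨ *-mono-≤ (*-mono-≤ (x≤N 0F) (x≤N 1F)) (<⇒≤pred x<T) ⟩
  N * N * pred T     ≡⟨ rotate N (pred T) ⟩
  pred T * N * N     ∎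
  where
  open ≤-Reasoning
  rotate : ∀ a b → a * a * b ≡ b * a * a
  rotate = solve-∀

module _ {k N : ℕ} (H₀ : 3Graph (Fin (3 + k))) (G : 3Graph (Fin N)) where

  rest? : (g : Vec (Fin N) k) → Dec (IsEmbedding (rest H₀) G (lookup g))
  rest? g = isEmbedding? (rest H₀) G (lookup g)

  candidate? : ∀ j (g : Vec (Fin N) k) → Decidable (Candidate H₀ G j (lookup g))
  candidate? j g x = isEmbedding? (rest+ j H₀) G (x ∷ᶠ lookup g)

  #candidates : Fin 3 → Vec (Fin N) k → ℕ
  #candidates j g = count (candidate? j g)

  𝟙-embedding≤ : ∀ a b c g → 𝟙 (isEmbedding? H₀ G (lookup (a ∷ b ∷ c ∷ g))) ≤
    𝟙 (rest? g) * 𝟙 (candidate? 0F g a) * 𝟙 (candidate? 1F g b) * 𝟙 (candidate? 2F g c)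
  𝟙-embedding≤ a b c g = begin
    𝟙 (isEmbedding? H₀ G (lookup (a ∷ b ∷ c ∷ g)))
      ≤⟨ 𝟙-mono split (isEmbedding? H₀ G (lookup (a ∷ b ∷ c ∷ g)))
                      (((ρ? ×-dec c₀?) ×-dec c₁?) ×-dec c₂?) ⟩
    𝟙 (((ρ? ×-dec c₀?) ×-dec c₁?) ×-dec c₂?)
      ≡⟨ trans (𝟙-× ((ρ? ×-dec c₀?) ×-dec c₁?) c₂?)
           (cong (_* 𝟙 c₂?) (trans (𝟙-× (ρ? ×-dec c₀?) c₁?) (cong (_* 𝟙 c₁?) (𝟙-× ρ? c₀?)))) ⟩
    𝟙 ρ? * 𝟙 c₀? * 𝟙 c₁? * 𝟙 c₂? ∎
    where
    open ≤-Reasoning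
    ρ? : Dec (IsEmbedding (rest H₀) G (lookup g))
    ρ? = rest? g
    c₀? : Dec (Candidate H₀ G 0F (lookup g) a)
    c₀? = candidate? 0F g a
    c₁? : Dec (Candidate H₀ G 1F (lookup g) b)
    c₁? = candidate? 1F g b
    c₂? : Dec (Candidate H₀ G 2F (lookup g) c)
    c₂? = candidate? 2F g c
    split : IsEmbedding H₀ G (lookup (a ∷ b ∷ c ∷ g)) →
      ((IsEmbedding (rest H₀) G (lookup g) × Candidate H₀ G 0F (lookup g) a) ×
        Candidate H₀ G 1F (lookup g) b) × Candidate H₀ G 2F (lookup g) c
    split e = let ρ-emb , candidates = IsEmbedding-split {H₀ = H₀} {G} e in
      ((ρ-emb , candidates 0F) , candidates 1F) , candidates 2F

  #embeddings≤ : #embeddings H₀ G ≤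
    ∑Vec k N (λ g → 𝟙 (rest? g) * #candidates 0F g * #candidates 1F g * #candidates 2F g)
  #embeddings≤ = begin
    ∑[ a < N ] ∑[ b < N ] ∑[ c < N ] ∑Vec k N (λ g → 𝟙 (isEmbedding? H₀ G (lookup (a ∷ b ∷ c ∷ g))))
      ≤⟨ sum-mono-≤ (λ a → sum-mono-≤ λ b → sum-mono-≤ λ c → ∑Vec-mono-≤ k (𝟙-embedding≤ a b c)) ⟩
    ∑[ a < N ] ∑[ b < N ] ∑[ c < N ] ∑Vec k N (X a b c)
      ≡⟨ sum-cong-≗ (λ a → sum-cong-≗ λ b → ∑Vec-∑-comm k (λ g c → X a b c g)) ⟨
    ∑[ a < N ] ∑[ b < N ] ∑Vec k N (λ g → ∑[ c < N ] X a b c g)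
      ≡⟨ sum-cong-≗ (λ a → ∑Vec-∑-comm k (λ g b → ∑[ c < N ] X a b c g)) ⟨
    ∑[ a < N ] ∑Vec k N (λ g → ∑[ b < N ] ∑[ c < N ] X a b c g)
      ≡⟨ ∑Vec-∑-comm k (λ g a → ∑[ b < N ] ∑[ c < N ] X a b c g) ⟨
    ∑Vec k N (λ g → ∑[ a < N ] ∑[ b < N ] ∑[ c < N ] X a b c g)
      ≡⟨ ∑Vec-cong k (λ g → trans
           (∑∑∑-* (λ a → 𝟙 (rest? g) * 𝟙 (candidate? 0F g a))
                  (𝟙 ∘ candidate? 1F g) (𝟙 ∘ candidate? 2F g))
           (cong (λ s → s * #candidates 1F g * #candidates 2F g)
                 (sym (*-distribˡ-sum (𝟙 (rest? g)) (𝟙 ∘ candidate? 0F g))))) ⟩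
    ∑Vec k N (λ g → 𝟙 (rest? g) * #candidates 0F g * #candidates 1F g * #candidates 2F g) ∎
    where
    open ≤-Reasoning
    X : Fin N → Fin N → Fin N → Vec (Fin N) k → ℕ
    X a b c g = 𝟙 (rest? g) * 𝟙 (candidate? 0F g a) * 𝟙 (candidate? 1F g b) * 𝟙 (candidate? 2F g c)

  RichRest : ℕ → Vec (Fin N) k → Set
  RichRest T g = IsEmbedding (rest H₀) G (lookup g) × (∀ j → T ≤ #candidates j g)

  richRest? : ∀ T → Decidable (RichRest T)
  richRest? T g = rest? g ×-dec all? (λ j → T ≤? #candidates j g)

  #embeddings≤-without-richRest : ∀ {T} → (∀ g → ¬ RichRest T g) →
    #embeddings H₀ G ≤ N ^ k * (pred T * N * N)
  #embeddings≤-without-richRest {T} poor =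
    ≤-trans #embeddings≤ (≤-trans (∑Vec-mono-≤ k bound) (≤-reflexive (∑Vec-const k (pred T * N * N))))
    where
    bound : ∀ g → 𝟙 (rest? g) * #candidates 0F g * #candidates 1F g * #candidates 2F g ≤ pred T * N * N
    bound g = bounded (rest? g)
      where
      bounded : (ρ? : Dec (IsEmbedding (rest H₀) G (lookup g))) →
        𝟙 ρ? * #candidates 0F g * #candidates 1F g * #candidates 2F g ≤ pred T * N * N
      bounded (no _)      = z≤n
      bounded (yes ρ-emb) =
        let j , few = ¬∀⟶∃¬ 3 (λ j → T ≤ #candidates j g) (λ j → T ≤? #candidates j g)
                             (λ large → poor g (ρ-emb , large)) in
        ≤-trans (≤-reflexive (cong (λ s → s * #candidates 1F g * #candidates 2F g)
                                   (*-identityˡ (#candidates 0F g))))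
          (product-bound (λ j → #candidates j g) (λ j → count≤ (candidate? j g)) j (≰⇒> few))

  extend-richRest : ∀ {n} → PairFree H₀ 0F 1F 2F → (g : Vec (Fin N) k) → RichRest (3 * n) g →
    Contains (complement G) (Knnn n) ⊎ EmbeddingOntoEdge H₀ G
  extend-richRest {n} pairFree g (ρ-emb , large)
    with T , T-injective , T-disjoint , T-candidate ← disjoint-families n (λ j → candidate? j g) large
    with any? (λ i → any? λ j → any? λ l → edge G (T 0F i) (T 1F j) (T 2F l) ≟ᴮ true)
  ... | yes (i , j , l , e) =
    inj₂ (τ ++ lookup g ,
          IsEmbedding-glue {H₀ = H₀} {G = G} pairFree τ-injective ρ-emb (λ p → T-candidate p (ι p)) , e)
    where
    ι : Fin 3 → Fin n
    ι = i ∷ᶠ j ∷ᶠ l ∷ᶠ []ᶠ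
    τ : Fin 3 → Fin N
    τ p = T p (ι p)
    τ-injective : Injective _≡_ _≡_ τ
    τ-injective {p} {q} e with p ≟ q
    ... | yes p≡q = p≡q
    ... | no p≢q  = ⊥-elim (T-disjoint p≢q (ι p) (ι q) e)
  ... | no no-edge = inj₁ (Knnn-in-complement G T T-injective T-disjoint
    λ i j l → ¬-not λ e → no-edge (i , j , l , e))

no-room : ∀ {T X} → 0 < T → 0 < X → T * X ≤ pred T * X → ⊥
no-room {suc T} {X} _ X>0 le = n≮n T (*-cancelʳ-≤ (suc T) T X {{>-nonZero X>0}} le)

module _ {k : ℕ} {H₀ : 3Graph (Fin (3 + k))} (pairFree : PairFree H₀ 0F 1F 2F)
  {n r : ℕ} (n≥1 : 1 ≤ n) (h≤r : 3 + k ≤ r) (arrows : Arrows r H₀ (Knnn n)) where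

  private
    h T R N : ℕ
    h = 3 + k
    T = 3 * n
    R = r ^ h
    N = T * R

    T>0 : 0 < T
    T>0 = *-mono-< {0} {3} (s≤s z≤n) n≥1

    r>0 : 0 < r
    r>0 = ≤-trans (s≤s z≤n) h≤r

    R>0 : 0 < R
    R>0 = m^n>0 r {{>-nonZero r>0}} h

    r≤N : r ≤ N
    r≤N = ≤-trans (m≤m*n r (r ^ (2 + k)) {{>-nonZero (m^n>0 r {{>-nonZero r>0}} (2 + k))}})
                  (m≤n*m R T {{>-nonZero T>0}})

    too-many-embeddings : (G : 3Graph (Fin N)) →
      N P′ h ≤ #embeddings H₀ G * (r P′ h) → #embeddings H₀ G ≤ N ^ k * (pred T * N * N) → ⊥
    -- In N ^ h * F = N * (N * (N * N ^ k)) * F the first factor N is read as T * R.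
    too-many-embeddings G lower upper = no-room T>0 X>0 (begin
      T * X                            ≡⟨ regroupˡ T R N (N ^ k) F ⟩
      N ^ h * F                        ≤⟨ ^*P′≤P′*^ h r≤N ⟩
      (N P′ h) * R                     ≤⟨ *-monoˡ-≤ R lower ⟩
      #embeddings H₀ G * F * R         ≤⟨ *-monoˡ-≤ R (*-monoˡ-≤ F upper) ⟩
      N ^ k * (pred T * N * N) * F * R ≡⟨ regroupʳ (pred T) R N (N ^ k) F ⟩
      pred T * X                       ∎)
      where
      open ≤-Reasoning
      F X : ℕ
      F = r P′ h
      X = R * N * N * N ^ k * F
      N>0 : 0 < N
      N>0 = *-mono-< T>0 R>0
      X>0 : 0 < X
      X>0 = *-mono-< (*-mono-< (*-mono-< (*-mono-< R>0 N>0) N>0) (m^n>0 N {{>-nonZero N>0}} k))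
                     (P′-pos h≤r)
      regroupˡ : ∀ t ρ ν π φ → t * (ρ * ν * ν * π * φ) ≡ t * ρ * (ν * (ν * π)) * φ
      regroupˡ = solve-∀
      regroupʳ : ∀ t ρ ν π φ → π * (t * ν * ν) * φ * ρ ≡ t * (ρ * ν * ν * π * φ)
      regroupʳ = solve-∀

  edge-on-triple-or-Knnn : (G : 3Graph (Fin N)) →
    Contains (complement G) (Knnn n) ⊎ EmbeddingOntoEdge H₀ G
  edge-on-triple-or-Knnn G with ⊎-choiceⱽ k (toSum ∘ richRest? H₀ G T)
  ... | inj₁ (g , rich) = extend-richRest H₀ G pairFree g rich
  ... | inj₂ poor with supersaturation {H = H₀} {Knnn n} h≤r arrows (≤⇒≤′ r≤N) G
  ...   | inj₁ K⊆Gᶜ = inj₁ K⊆Gᶜ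
  ...   | inj₂ lower = ⊥-elim (too-many-embeddings G lower (#embeddings≤-without-richRest H₀ G poor))

-- Relabelling u, v, w as 0, 1, 2

permutation-from-first3 : ∀ {k} {u v w : Fin (3 + k)} → Distinct3 u v w →
  ∃ λ (π : Permutation′ (3 + k)) → π ⟨$⟩ʳ 0F ≡ u × π ⟨$⟩ʳ 1F ≡ v × π ⟨$⟩ʳ 2F ≡ w
permutation-from-first3 {k} {u} {v} {w} (u≢v , v≢w , u≢w) =
  insert 0F u (insert 0F v′ (insert 0F w″ id)) , refl , punchIn-punchOut u≢v , π2≡w
  where
  v′ w′ : Fin (2 + k)
  v′ = punchOut u≢v
  w′ = punchOut u≢w
  v′≢w′ : v′ ≢ w′
  v′≢w′ v′≡w′ =
    v≢w (trans (sym (punchIn-punchOut u≢v)) (trans (cong (punchIn u) v′≡w′) (punchIn-punchOut u≢w)))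
  w″ : Fin (suc k)
  w″ = punchOut v′≢w′
  π2≡w : punchIn u (punchIn v′ w″) ≡ w
  π2≡w = trans (cong (punchIn u) (punchIn-punchOut v′≢w′)) (punchIn-punchOut u≢w)

module _ {h : ℕ} (π : Permutation′ h) where

  π-injective : Injective _≡_ _≡_ (π ⟨$⟩ʳ_)
  π-injective e = trans (sym (inverseˡ π)) (trans (cong (π ⟨$⟩ˡ_) e) (inverseˡ π))

  π⁻¹-injective : Injective _≡_ _≡_ (π ⟨$⟩ˡ_)
  π⁻¹-injective e = trans (sym (inverseʳ π)) (trans (cong (π ⟨$⟩ʳ_) e) (inverseʳ π))

  IsEmbedding-unrelabel : ∀ {V : Set} {H : 3Graph (Fin h)} {G : 3Graph V} {F : Fin h → V} →
    IsEmbedding (pullback (π ⟨$⟩ʳ_) H) G F → IsEmbedding H G (F ∘ (π ⟨$⟩ˡ_))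
  IsEmbedding-unrelabel {H = H} {G} F-emb =
    IsEmbedding-⊆ {H = pullback (π ⟨$⟩ˡ_) (pullback (π ⟨$⟩ʳ_) H)} {H} {G}
      (λ a b c e → trans (edge-cong H (inverseʳ π) (inverseʳ π) (inverseʳ π)) e)
      (IsEmbedding-restrict {H = pullback (π ⟨$⟩ʳ_) H} {G = G} π⁻¹-injective F-emb)

  Arrows-relabel : ∀ {r} {W : Set} {H : 3Graph (Fin h)} {K : 3Graph W} →
    Arrows r H K → Arrows r (pullback (π ⟨$⟩ʳ_) H) K
  Arrows-relabel {H = H} arrows G = map₁ (λ (φ , φ-emb) →
    φ ∘ (π ⟨$⟩ʳ_) , IsEmbedding-restrict {H = H} {G = G} π-injective φ-emb) (arrows G)

proposition7p2 : (h : ℕ) → 3 ≤ h → (H : 3Graph (Fin h)) → (u v w : Fin h) →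
    Distinct3 u v w → PairFree H u v w →
    (n : ℕ) → 1 ≤ n → (r : ℕ) → IsRamseyNumber H (Knnn n) r →
    Arrows (3 * n * r ^ h) (addEdge H u v w) (Knnn n)
proposition7p2 zero                ()
proposition7p2 (suc zero)          (s≤s ())
proposition7p2 (suc (suc zero))    (s≤s (s≤s ()))
proposition7p2 (suc (suc (suc k))) _ H u v w uvw pairFree n n≥1 r (arrows , _) G
  with π , π0≡u , π1≡v , π2≡w ← permutation-from-first3 {u = u} {v} {w} uvw
  with edge-on-triple-or-Knnn {H₀ = pullback (π ⟨$⟩ʳ_) H}
         (PairFree-pullback {H = H} (π-injective π) π0≡u π1≡v π2≡w pairFree) n≥1
         (Arrows⇒≤ {H = H} {Knnn n} (Knnn-has-edge n≥1) arrows)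
         (Arrows-relabel π {H = H} {Knnn n} arrows) G
... | inj₁ K⊆Gᶜ = inj₂ K⊆Gᶜ
... | inj₂ (F , F-emb , e) =
  inj₁ (Contains-addEdge {H = H} {G} (IsEmbedding-unrelabel π {H = H} {G} F-emb)
          (trans (edge-cong G (cong F (preimage π0≡u)) (cong F (preimage π1≡v)) (cong F (preimage π2≡w))) e))
  where
  preimage : ∀ {i x} → π ⟨$⟩ʳ i ≡ x → π ⟨$⟩ˡ x ≡ i
  preimage refl = inverseˡ π
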